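{- Let $(T_r)_{r\in\mathbb{Z}}$ be the Tribonacci sequence. Then for every non-negative integer $k$: \[ 8\sum_{j=1}^k (-1)^{j-1} T_{2j-1}^2 = (-1)^k\left(T_{2k}^2 - 9T_{2k-1}^2 - 6T_{2k-2}^2 + T_{2k-4}^2 + T_{2k-5}^2\right) + 2 . \]
   Context: The Tribonacci sequence $(T_r)_{r\in\mathbb{Z}}$ is defined by $T_0=0$, $T_1=1$, $T_2=1$ and $T_r=T_{r-1}+T_{r-2}+T_{r-3}$ for all integers $r$ (this determines $T_r$ for negative $r$ as well). An empty sum equals $0$. -}

module Defs where

open import Data.Nat using (ℕ; zero; suc)
open import Data.Integer using (ℤ; +_; -[1+_]; _+_; _-_; _*_; -_)
open import Data.Product using (_×_; _,_; proj₁)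

-- Forward triples: fwd n = (T n , T (n+1) , T (n+2)) for n : ℕ
fwd : ℕ → ℤ × ℤ × ℤ
fwd zero = (+ 0 , + 1 , + 1)
fwd (suc n) with fwd n
... | (a , b , c) = (b , c , a + b + c)

-- Backward triples: bwd n = (T (-n) , T (-n+1) , T (-n+2)), using
-- T (r-3) = T r - T (r-1) - T (r-2)
bwd : ℕ → ℤ × ℤ × ℤ
bwd zero = (+ 0 , + 1 , + 1)
bwd (suc n) with bwd n
... | (a , b , c) = (c - b - a , a , b)

T : ℤ → ℤ
T (+ n) = proj₁ (fwd n)
T -[1+ n ] = proj₁ (bwd (suc n))

sgn : ℕ → ℤ
sgn zero = + 1
sgn (suc n) = - sgn n

sumFrom1 : ℕ → (ℕ → ℤ) → ℤ
sumFrom1 zero f = + 0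
sumFrom1 (suc k) f = sumFrom1 k f + f (suc k)

-- The bracket Q(n) = T_n² − 9T_{n−1}² − 6T_{n−2}² + T_{n−4}² + T_{n−5}² satisfies
-- Q(n) + Q(n+2) = −8 T_{n+1}² for every integer n: writing the eight terms T_{n−5}, …, T_{n+2}
-- through the first three by the recurrence, this is a polynomial identity. Hence
-- 8(−1)^{k} T_{2k+1}² = (−1)^{k+1} Q(2k+2) − (−1)^k Q(2k), the alternating sum telescopes,
-- and the constant 2 is 8·0 − Q(0).
module Submission where

open import Defs
open import Data.Nat using (ℕ; zero; suc)
import Data.Nat as ℕ
import Data.Nat.Properties as ℕₚ
open import Data.Integer using (ℤ; +_; -[1+_]; _+_; _-_; _*_; -_)
open import Data.Integer.Properties using (+-assoc; neg-involutive)
open import Data.List using (_∷_; [])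
open import Relation.Binary.PropositionalEquality
open import Data.Integer.Tactic.RingSolver
open ≡-Reasoning

T-rec : ∀ r → T (r + + 3) ≡ T r + T (r + + 1) + T (r + + 2)
T-rec (+ n) rewrite ℕₚ.+-comm n 3 | ℕₚ.+-comm n 2 | ℕₚ.+-comm n 1 = refl
T-rec -[1+ 0 ] = refl
T-rec -[1+ 1 ] = refl
T-rec -[1+ 2 ] = refl
T-rec -[1+ suc (suc (suc m)) ] = backward _ _ _
  where
  backward : ∀ a b c → c ≡ (c - b - a) + a + b
  backward = solve-∀

Q : (ℤ → ℤ) → ℤ → ℤ
Q u n = u n * u n
        - + 9 * (u (n - + 1) * u (n - + 1))
        - + 6 * (u (n - + 2) * u (n - + 2))
        + u (n - + 4) * u (n - + 4)
        + u (n - + 5) * u (n - + 5)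

tribonacci-square-identity : ∀ a b c {d e f g h : ℤ} →
  d ≡ a + b + c → e ≡ b + c + d → f ≡ c + d + e → g ≡ d + e + f → h ≡ e + f + g →
  (f * f - + 9 * (e * e) - + 6 * (d * d) + b * b + a * a)
    + (h * h - + 9 * (g * g) - + 6 * (f * f) + d * d + c * c)
    ≡ - (+ 8 * (g * g))
tribonacci-square-identity a b c refl refl refl refl refl = solve (a ∷ b ∷ c ∷ [])

-- Indices are written as r + + j with j : ℕ, so that +-assoc turns (r + + i) ± + j into
-- r + + (i ± j) with the offset computed definitionally.
module _ (u : ℤ → ℤ) (rec : ∀ r → u (r + + 3) ≡ u r + u (r + + 1) + u (r + + 2)) where

  rec-offset : ∀ r j → u (r + + (j ℕ.+ 3)) ≡ u (r + + j) + u (r + + (j ℕ.+ 1)) + u (r + + (j ℕ.+ 2))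
  rec-offset r j = begin
    u (r + + (j ℕ.+ 3))                    ≡⟨ cong u (+-assoc r (+ j) (+ 3)) ⟨
    u (r + + j + + 3)                      ≡⟨ rec (r + + j) ⟩
    u (r + + j) + u (r + + j + + 1) + u (r + + j + + 2)
      ≡⟨ cong₂ (λ x y → u (r + + j) + u x + u y) (+-assoc r (+ j) (+ 1)) (+-assoc r (+ j) (+ 2)) ⟩
    u (r + + j) + u (r + + (j ℕ.+ 1)) + u (r + + (j ℕ.+ 2)) ∎

  Q-offset : ∀ r j → Q u (r + + (5 ℕ.+ j)) ≡
    u (r + + (5 ℕ.+ j)) * u (r + + (5 ℕ.+ j))
    - + 9 * (u (r + + (4 ℕ.+ j)) * u (r + + (4 ℕ.+ j)))
    - + 6 * (u (r + + (3 ℕ.+ j)) * u (r + + (3 ℕ.+ j)))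
    + u (r + + (1 ℕ.+ j)) * u (r + + (1 ℕ.+ j))
    + u (r + + j) * u (r + + j)
  Q-offset r j
    rewrite +-assoc r (+ (5 ℕ.+ j)) (- + 1) | +-assoc r (+ (5 ℕ.+ j)) (- + 2)
          | +-assoc r (+ (5 ℕ.+ j)) (- + 4) | +-assoc r (+ (5 ℕ.+ j)) (- + 5) = refl

  Q-step : ∀ r → Q u (r + + 5) + Q u (r + + 7) ≡ - (+ 8 * (u (r + + 6) * u (r + + 6)))
  Q-step r = begin
    Q u (r + + 5) + Q u (r + + 7) ≡⟨ cong₂ _+_ (Q-offset r 0) (Q-offset r 2) ⟩
    _                             ≡⟨ tribonacci-square-identity (u (r + + 0)) (u (r + + 1)) (u (r + + 2))
                                       (rec-offset r 0) (rec-offset r 1)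
                                       (rec-offset r 2) (rec-offset r 3) (rec-offset r 4) ⟩
    - (+ 8 * (u (r + + 6) * u (r + + 6))) ∎

Q-T-step : ∀ k → Q T (+ 2 * + k) + Q T (+ 2 * + suc k)
                   ≡ - (+ 8 * (T (+ 2 * + suc k - + 1) * T (+ 2 * + suc k - + 1)))
Q-T-step k = begin
  Q T (+ 2 * + k) + Q T (+ 2 * + suc k)
    ≡⟨ cong₂ (λ m n → Q T m + Q T n) (at5 (+ k)) (at7 (+ k)) ⟩
  Q T (r + + 5) + Q T (r + + 7)
    ≡⟨ Q-step T T-rec r ⟩
  - (+ 8 * (T (r + + 6) * T (r + + 6)))
    ≡⟨ cong (λ m → - (+ 8 * (T m * T m))) (at6 (+ k)) ⟨
  - (+ 8 * (T (+ 2 * + suc k - + 1) * T (+ 2 * + suc k - + 1))) ∎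
  where
  r : ℤ
  r = + 2 * + k - + 5
  at5 : ∀ n → + 2 * n ≡ + 2 * n - + 5 + + 5
  at5 = solve-∀
  at6 : ∀ n → + 2 * (+ 1 + n) - + 1 ≡ + 2 * n - + 5 + + 6
  at6 = solve-∀
  at7 : ∀ n → + 2 * (+ 1 + n) ≡ + 2 * n - + 5 + + 7
  at7 = solve-∀

alternating-telescope : ∀ {S X B : ℤ} s A → + 8 * S ≡ s * A + + 2 → A + B ≡ - (+ 8 * X) →
                        + 8 * (S + s * X) ≡ - s * B + + 2
alternating-telescope {S} {X} {B} s A sum≡ step = begin
  + 8 * (S + s * X)               ≡⟨ solve (S ∷ s ∷ X ∷ []) ⟩
  + 8 * S + s * (+ 8 * X)         ≡⟨ cong₂ _+_ sum≡ (cong (s *_) 8X≡-[A+B]) ⟩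
  s * A + + 2 + s * - (A + B)     ≡⟨ solve (s ∷ A ∷ B ∷ []) ⟩
  - s * B + + 2                   ∎
  where
  8X≡-[A+B] : + 8 * X ≡ - (A + B)
  8X≡-[A+B] = trans (sym (neg-involutive _)) (cong -_ (sym step))

mainTheorem8 : (k : ℕ) →
    + 8 * sumFrom1 k (λ j → sgn (j Data.Nat.∸ 1) * (T (+ 2 * + j - + 1) * T (+ 2 * + j - + 1)))
      ≡ sgn k * (T (+ 2 * + k) * T (+ 2 * + k)
                 - + 9 * (T (+ 2 * + k - + 1) * T (+ 2 * + k - + 1))
                 - + 6 * (T (+ 2 * + k - + 2) * T (+ 2 * + k - + 2))
                 + T (+ 2 * + k - + 4) * T (+ 2 * + k - + 4)
                 + T (+ 2 * + k - + 5) * T (+ 2 * + k - + 5))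
        + + 2
mainTheorem8 zero = refl
mainTheorem8 (suc k) = alternating-telescope (sgn k) (Q T (+ 2 * + k)) (mainTheorem8 k) (Q-T-step k)
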